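{- Let $D$ be a digraph and let $S$ be a maximum stable set of $D$ with $|S|\ge 2$. If $D$ is $\alpha$-diperfect, then for every pair of distinct vertices $u,v\in S$, $\lambda(D-u)\geq \left\lceil \frac{|V(D)|}{\alpha(D)}\right\rceil$ or $\lambda(D-v)\geq \left\lceil \frac{|V(D)|}{\alpha(D)}\right\rceil$.
   Context: A path in a digraph means a directed path: a sequence of distinct vertices in which each vertex has an arc to its successor. $\lambda(D)$ denotes the maximum number of vertices of a path in $D$. A stable set of $D$ is a stable set of its underlying undirected graph, and $\alpha(D)$ is the size of a maximum stable set. A path partition of $D$ is a collection of vertex-disjoint paths covering $V(D)$; a stable set $S$ and a path partition $\mathcal{P}$ are orthogonal if every path of $\mathcal{P}$ contains exactly one vertex of $S$. A digraph $D$ is $\alpha$-diperfect if for every induced subdigraph $H$ of $D$ and every maximum stable set $S$ of $H$ there is a path partition of $H$ orthogonal to $S$. -}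

module Defs where

open import Data.Nat using (ℕ; zero; suc; _+_; _∸_; _≤_; _/_)
open import Data.Fin using (Fin)
open import Data.Fin.Subset using (Subset; _∈_; _∉_; _⊆_; ∣_∣; ⊤; _-_)
open import Data.List using (List; []; _∷_; length; concat; filter; map)
open import Data.List.Relation.Unary.All using (All)
open import Data.List.Relation.Unary.Unique.Propositional using (Unique)
open import Data.List.Relation.Unary.Any using (Any)
open import Data.List.Membership.Propositional renaming (_∈_ to _∈ˡ_)
open import Data.Unit renaming (⊤ to Unit)
open import Data.Product using (Σ; _×_; ∃)
open import Relation.Binary.PropositionalEquality using (_≡_; _≢_)
open import Relation.Nullary using (¬_)
open import Data.Fin.Subset.Properties using (_∈?_)

record Digraph (n : ℕ) : Set₁ where
  field
    Arc : Fin n → Fin n → Set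

open Digraph public

module _ {n : ℕ} (D : Digraph n) where

  Chain : List (Fin n) → Set
  Chain []           = Unit
  Chain (x ∷ [])     = Unit
  Chain (x ∷ y ∷ xs) = Arc D x y × Chain (y ∷ xs)

  IsPathIn : Subset n → List (Fin n) → Set
  IsPathIn X P = ¬ (P ≡ []) × Unique P × All (_∈ X) P × Chain P

  IsStableIn : Subset n → Subset n → Set
  IsStableIn X S = S ⊆ X × (∀ x y → x ∈ S → y ∈ S → x ≢ y → ¬ Arc D x y)

  IsMaxStableIn : Subset n → Subset n → Set
  IsMaxStableIn X S = IsStableIn X S × (∀ T → IsStableIn X T → ∣ T ∣ ≤ ∣ S ∣)

  IsPathPartitionIn : Subset n → List (List (Fin n)) → Set
  IsPathPartitionIn X 𝒫 =
    All (IsPathIn X) 𝒫 × Unique (concat 𝒫) × (∀ x → x ∈ X → x ∈ˡ concat 𝒫)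

  countIn : Subset n → List (Fin n) → ℕ
  countIn S P = length (filter (_∈? S) P)

  Orthogonal : Subset n → List (List (Fin n)) → Set
  Orthogonal S 𝒫 = All (λ P → countIn S P ≡ 1) 𝒫

  AlphaDiperfect : Set
  AlphaDiperfect = ∀ X S → IsMaxStableIn X S →
    ∃ λ 𝒫 → IsPathPartitionIn X 𝒫 × Orthogonal S 𝒫

  AlphaIs : ℕ → Set
  AlphaIs a = (∃ λ S → IsStableIn ⊤ S × ∣ S ∣ ≡ a) × (∀ T → IsStableIn ⊤ T → ∣ T ∣ ≤ a)

  LongestPathAtLeast : Subset n → ℕ → Set
  LongestPathAtLeast X k = ∃ λ P → IsPathIn X P × k ≤ length P

-- ⌈ m / d ⌉ for d ≥ 1 (d = 0 gives 0, never used)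
⌈_/_⌉ : ℕ → ℕ → ℕ
⌈ m / zero ⌉  = 0
⌈ m / suc d ⌉ = (m + d) / suc d

{-# OPTIONS --safe #-}
-- As D is α-diperfect, it has a path partition 𝒫 orthogonal to S. Each path of 𝒫 meets
-- S exactly once, so 𝒫 has |S| ≤ α(D) paths; since they cover all n vertices, one of
-- them, P, has at least ⌈n / α(D)⌉ vertices. Containing only one vertex of S, P misses u
-- or v, and is therefore a path of D - u or of D - v.
module Submission where

open import Defs
open import Data.Nat using (ℕ; zero; suc; pred; _+_; _*_; _≤_; _<_; NonZero; >-nonZero⁻¹; z≤n; s≤s; _<?_)
open import Data.Nat.Properties
  using (+-comm; *-comm; ≤-trans; ≮⇒≥; +-monoˡ-≤; *-monoˡ-≤; +-cancelˡ-<; +-cancelʳ-≤; module ≤-Reasoning)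
open import Data.Nat.DivMod using (_/_; m/n*n≤m)
open import Data.Fin using (Fin)
open import Data.Fin.Properties using (injective⇒≤; nonZeroIndex; _≟_)
open import Data.Fin.Subset using (Subset; _∈_; ∣_∣; ⊤; _-_)
open import Data.Fin.Subset.Properties
  using (_∈?_; x∈p∧x∉q⇒x∈p─q; x∈⁅y⁆⇒x≡y; x∈p⇒p-x⊂p; p⊂q⇒∣p∣<∣q∣; ∈⊤)
open import Data.List using (List; []; _∷_; _++_; length; concat; filter; lookup)
open import Data.List.Properties using (length-++; filter-++)
open import Data.List.Relation.Unary.All as All using (All; []; _∷_)
open import Data.List.Relation.Unary.Any as Any using (Any; here; there; any?)
open import Data.List.Relation.Unary.Any.Properties using (lookup-index)
open import Data.List.Relation.Unary.AllPairs using (_∷_)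
open import Data.List.Relation.Unary.Unique.Propositional using (Unique)
import Data.List.Relation.Unary.Unique.Propositional.Properties as Unique
open import Data.List.Membership.Propositional renaming (_∈_ to _∈ˡ_; _∉_ to _∉ˡ_)
open import Data.List.Membership.Propositional.Properties using (∈-filter⁺; ∈-filter⁻)
open import Data.Product using (_,_; proj₂; ∃; _×_)
open import Data.Sum as Sum using (_⊎_; inj₁; inj₂)
open import Function using (_∘_)
open import Relation.Nullary using (yes; no; contradiction)
open import Relation.Unary using (Pred; Decidable)
open import Relation.Binary.PropositionalEquality
  using (_≡_; _≢_; refl; sym; trans; cong; subst; cong₂; module ≡-Reasoning)

∈-remove⁺ : ∀ {n} {x y : Fin n} {p : Subset n} → x ∈ p → x ≢ y → x ∈ p - y
∈-remove⁺ {y = y} x∈p x≢y = x∈p∧x∉q⇒x∈p─q x∈p (x≢y ∘ x∈⁅y⁆⇒x≡y y)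

unique⇒length≤∣p∣ : ∀ {n} (p : Subset n) {xs : List (Fin n)} →
  Unique xs → All (_∈ p) xs → length xs ≤ ∣ p ∣
unique⇒length≤∣p∣ p {[]}     _             _            = z≤n
unique⇒length≤∣p∣ p {x ∷ xs} (x∉xs ∷ uniq) (x∈p ∷ xs⊆p) = begin
  suc (length xs) ≤⟨ s≤s (unique⇒length≤∣p∣ (p - x) uniq xs⊆p-x) ⟩
  suc ∣ p - x ∣    ≤⟨ p⊂q⇒∣p∣<∣q∣ (x∈p⇒p-x⊂p x∈p) ⟩
  ∣ p ∣            ∎
  where
  open ≤-Reasoning
  xs⊆p-x : All (_∈ p - x) xs
  xs⊆p-x = All.zipWith (λ (y∈p , x≢y) → ∈-remove⁺ y∈p (x≢y ∘ sym)) (xs⊆p , x∉xs)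

complete⇒n≤length : ∀ {n} (xs : List (Fin n)) → (∀ x → x ∈ˡ xs) → n ≤ length xs
complete⇒n≤length xs x∈xs = injective⇒≤ index-injective
  where
  index-injective : ∀ {x y} → Any.index (x∈xs x) ≡ Any.index (x∈xs y) → x ≡ y
  index-injective {x} {y} eq = trans (lookup-index (x∈xs x))
    (trans (cong (lookup xs) eq) (sym (lookup-index (x∈xs y))))

module _ {a p} {A : Set a} {P : Pred A p} (P? : Decidable P) where

  length-filter-concat : (xss : List (List A)) →
    All (λ xs → length (filter P? xs) ≡ 1) xss → length (filter P? (concat xss)) ≡ length xss
  length-filter-concat []         []           = refl
  length-filter-concat (xs ∷ xss) (one ∷ ones) = begin
    length (filter P? (xs ++ concat xss))                   ≡⟨ cong length (filter-++ P? xs (concat xss)) ⟩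
    length (filter P? xs ++ filter P? (concat xss))         ≡⟨ length-++ (filter P? xs) ⟩
    length (filter P? xs) + length (filter P? (concat xss)) ≡⟨ cong₂ _+_ one (length-filter-concat xss ones) ⟩
    suc (length xss)                                        ∎
    where open ≡-Reasoning

length-concat>⇒any-length> : ∀ {a} {A : Set a} k (xss : List (List A)) →
  length xss * k < length (concat xss) → Any (λ xs → k < length xs) xss
length-concat>⇒any-length> k []         ()
length-concat>⇒any-length> k (xs ∷ xss) long with k <? length xs
... | yes k<xs = here k<xs
... | no  k≮xs = there (length-concat>⇒any-length> k xss (+-cancelˡ-< k _ _ (begin-strict
  k + length xss * k              <⟨ long ⟩
  length (xs ++ concat xss)       ≡⟨ length-++ xs ⟩
  length xs + length (concat xss) ≤⟨ +-monoˡ-≤ _ (≮⇒≥ k≮xs) ⟩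
  k + length (concat xss)         ∎)))
  where open ≤-Reasoning

*pred⌈m/d⌉<m : ∀ m d .{{_ : NonZero m}} → suc d * pred ⌈ m / suc d ⌉ < m
*pred⌈m/d⌉<m m d = subst (_< m) (*-comm (pred ⌈ m / suc d ⌉) (suc d))
  (bound ⌈ m / suc d ⌉ (m/n*n≤m (m + d) (suc d)))
  where
  bound : ∀ q → q * suc d ≤ m + d → pred q * suc d < m
  bound zero    _      = >-nonZero⁻¹ m
  bound (suc q) qd≤m+d = +-cancelʳ-≤ d _ m (begin
    suc (q * suc d) + d ≡⟨ cong suc (+-comm (q * suc d) d) ⟩
    suc q * suc d       ≤⟨ qd≤m+d ⟩
    m + d               ∎)
    where open ≤-Reasoning

pred<⇒≤ : ∀ {m n} → pred m < n → m ≤ n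
pred<⇒≤ {zero}  _   = z≤n
pred<⇒≤ {suc _} m<n = m<n

∈-length≡1⇒≡ : ∀ {a} {A : Set a} {x y : A} {xs : List A} → x ∈ˡ xs → y ∈ˡ xs → length xs ≡ 1 → x ≡ y
∈-length≡1⇒≡ {xs = _ ∷ []} (here refl) (here refl) _ = refl

module _ {n} (D : Digraph n) where

  IsPathIn-remove : ∀ {X P w} → IsPathIn D X P → w ∉ˡ P → IsPathIn D (X - w) P
  IsPathIn-remove (nonempty , unique , P⊆X , chain) w∉P =
    nonempty , unique , All.tabulate (λ x∈P → ∈-remove⁺ (All.lookup P⊆X x∈P) λ { refl → w∉P x∈P }) , chain

  countIn≡1⇒misses : ∀ {S P u v} → countIn D S P ≡ 1 → u ∈ S → v ∈ S → u ≢ v → u ∉ˡ P ⊎ v ∉ˡ P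
  countIn≡1⇒misses {S} {P} {u} {v} one u∈S v∈S u≢v with any? (u ≟_) P | any? (v ≟_) P
  ... | no u∉P | _      = inj₁ u∉P
  ... | yes _  | no v∉P = inj₂ v∉P
  ... | yes u∈P | yes v∈P =
    contradiction (∈-length≡1⇒≡ (∈-filter⁺ (_∈? S) u∈P u∈S) (∈-filter⁺ (_∈? S) v∈P v∈S) one) u≢v

  orthogonal⇒length≤∣S∣ : ∀ {S 𝒫} → Unique (concat 𝒫) → Orthogonal D S 𝒫 → length 𝒫 ≤ ∣ S ∣
  orthogonal⇒length≤∣S∣ {S} {𝒫} unique orth = begin
    length 𝒫                          ≡⟨ sym (length-filter-concat (_∈? S) 𝒫 orth) ⟩
    length (filter (_∈? S) (concat 𝒫)) ≤⟨ unique⇒length≤∣p∣ S (Unique.filter⁺ (_∈? S) unique) ⊆S ⟩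
    ∣ S ∣                              ∎
    where
    open ≤-Reasoning
    ⊆S : All (_∈ S) (filter (_∈? S) (concat 𝒫))
    ⊆S = All.tabulate (proj₂ ∘ ∈-filter⁻ (_∈? S) {xs = concat 𝒫})

  orthogonal-partition⇒long-path : ∀ {S 𝒫 a} .{{_ : NonZero n}} →
    IsPathPartitionIn D ⊤ 𝒫 → Orthogonal D S 𝒫 → ∣ S ∣ ≤ suc a →
    ∃ λ P → IsPathIn D ⊤ P × countIn D S P ≡ 1 × ⌈ n / suc a ⌉ ≤ length P
  orthogonal-partition⇒long-path {S} {𝒫} {a} (paths , unique , covers) orth ∣S∣≤1+a
    = Any.lookup long-path , All.lookupWith (λ (path , one) long → path , one , pred<⇒≤ long)
                                             (All.zip (paths , orth)) long-path
    where
    open ≤-Reasoning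
    short : length 𝒫 * pred ⌈ n / suc a ⌉ < length (concat 𝒫)
    short = begin-strict
      length 𝒫 * pred ⌈ n / suc a ⌉ ≤⟨ *-monoˡ-≤ _ (≤-trans (orthogonal⇒length≤∣S∣ unique orth) ∣S∣≤1+a) ⟩
      suc a * pred ⌈ n / suc a ⌉    <⟨ *pred⌈m/d⌉<m n a ⟩
      n                             ≤⟨ complete⇒n≤length (concat 𝒫) (λ x → covers x ∈⊤) ⟩
      length (concat 𝒫)             ∎
    long-path : Any (λ P → pred ⌈ n / suc a ⌉ < length P) 𝒫
    long-path = length-concat>⇒any-length> _ 𝒫 short

lemma1 : ∀ {n} (D : Digraph n) (S : Subset n) (a : ℕ) →
    AlphaIs D a → IsMaxStableIn D ⊤ S → 2 ≤ ∣ S ∣ →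
    AlphaDiperfect D →
    ∀ u v → u ∈ S → v ∈ S → u ≢ v →
      LongestPathAtLeast D (⊤ - u) ⌈ n / a ⌉ ⊎ LongestPathAtLeast D (⊤ - v) ⌈ n / a ⌉
lemma1 D S zero (_ , α≤) (stable , _) 2≤∣S∣ _ _ _ _ _ _ with () ← ≤-trans 2≤∣S∣ (α≤ S stable)
lemma1 D S (suc a) (_ , α≤) maxS@(stable , _) _ diperfect u v u∈S v∈S u≢v
  with 𝒫 , partition , orth ← diperfect ⊤ S maxS
  with P , path , one , long ← orthogonal-partition⇒long-path D {{nonZeroIndex u}} partition orth (α≤ S stable)
  = Sum.map (λ u∉P → P , IsPathIn-remove D path u∉P , long)
            (λ v∉P → P , IsPathIn-remove D path v∉P , long)
            (countIn≡1⇒misses D one u∈S v∈S u≢v)
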